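{- For each $n\in\mathbb{N}$ let $t_n$ denote the number of intervals of the partition $\rho_{1,1}^n$ and $t'_n$ the number of intervals of the partition $\rho_{4,1}^n$. Then $t'_n=t_{3n}$ for all $n\in\mathbb{N}$.
   Context: For positive integers $L,S$, let $\gamma$ be the positive root of $L\gamma+S\gamma^2=1$, and let $\rho_{L,S}$ be the partition of $[0,1[$ into $L$ consecutive intervals of length $\gamma$ followed by $S$ consecutive intervals of length $\gamma^2$. For a finite partition $\pi$ of $[0,1[$ into intervals, its $\rho_{L,S}$-refinement is obtained by subdividing every interval of $\pi$ of maximal length homothetically to $\rho_{L,S}$ (i.e. into $L$ subintervals of relative length $\gamma$ followed by $S$ of relative length $\gamma^2$), leaving the other intervals unchanged. Let $\omega=\{[0,1[\}$ and define $\rho_{L,S}^0=\omega$, $\rho_{L,S}^n$ = the $\rho_{L,S}$-refinement of $\rho_{L,S}^{n-1}$ for $n\ge1$. -}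

module Defs where

open import Data.Nat using (ℕ; zero; suc; _⊓_; _≡ᵇ_)
open import Data.Bool using (if_then_else_)
open import Data.List using (List; []; _∷_; _++_; replicate; concatMap; length)

-- A finite partition of [0,1[ into consecutive intervals whose lengths are
-- powers of γ is encoded by the list (left to right) of exponents k, the
-- interval having length γ^k.  Every partition ρ_{L,S}^n is of this form.
-- Since 0 < γ < 1, the intervals of maximal length are exactly those with
-- minimal exponent.
Partition : Set
Partition = List ℕ

-- minimal exponent (only used on nonempty lists)
minExp : Partition → ℕ
minExp []       = 0
minExp (k ∷ ks) = go k ks
  where
  go : ℕ → List ℕ → ℕ
  go m []       = m
  go m (x ∷ xs) = go (m ⊓ x) xs

-- ρ_{L,S}-refinement: each interval of maximal length γ^m is replaced by
-- L intervals of length γ^(m+1) followed by S intervals of length γ^(m+2).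
refine : ℕ → ℕ → Partition → Partition
refine L S π = concatMap step π
  where
  m = minExp π
  step : ℕ → List ℕ
  step k = if k ≡ᵇ m then replicate L (suc k) ++ replicate S (suc (suc k))
           else k ∷ []

ω : Partition
ω = 0 ∷ []

ρ^ : ℕ → ℕ → ℕ → Partition
ρ^ L S zero    = ω
ρ^ L S (suc n) = refine L S (ρ^ L S n)

t : ℕ → ℕ
t n = length (ρ^ 1 1 n)

t′ : ℕ → ℕ
t′ n = length (ρ^ 4 1 n)

{-# OPTIONS --safe #-}
module Submission where

open import Defs
open import Data.Nat using (ℕ; zero; suc; _+_; _*_; _≤_; _<_; _⊓_; _≡ᵇ_; s≤s; z≤n)
open import Data.Nat.Properties
  using (≤-refl; n≤1+n; ⊓-glb; m≤n⇒m⊓n≡m; m≥n⇒m⊓n≡n; *-zeroʳ; *-suc; m≤n*m; m≤n+m; <-≤-trans; ≤-trans; +-suc)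
open import Data.Nat.Tactic.RingSolver using (solve-∀)
open import Data.Bool using (true; false; if_then_else_)
open import Data.List using (List; []; _∷_; _++_; replicate; concatMap; length)
open import Data.List.Properties using (++-assoc)
open import Data.Product using (_×_; _,_; proj₁)
open import Data.Sum using (_⊎_; inj₁; inj₂)
open import Relation.Binary.PropositionalEquality
  using (_≡_; refl; sym; trans; cong; cong₂; subst; module ≡-Reasoning)

-- Every ρ_{L,S}^n has only intervals of two sizes, γ^n and γ^(n+1), so it is
-- described by the pair (a , b) of their numbers, on which refinement acts
-- linearly: (a , b) ↦ (b + L a , S a).  Three steps of ρ_{1,1} send (a , b) to
-- (3a + 2b , 2a + b), one step of ρ_{4,1} sends (x , y) to (y + 4x , x), and
-- the invariant  x = a + y , b = 2y  relating ρ_{4,1}^n to ρ_{1,1}^{3n} is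
-- preserved; it forces x + y = a + b.

total : ℕ × ℕ → ℕ
total (a , b) = a + b

refineCounts : ℕ → ℕ → ℕ × ℕ → ℕ × ℕ
refineCounts L S (a , b) = b + L * a , S * a

counts : ℕ → ℕ → ℕ → ℕ × ℕ
counts L S zero    = 1 , 0
counts L S (suc n) = refineCounts L S (counts L S n)

data Shape (m : ℕ) : ℕ × ℕ → Partition → Set where
  []    : Shape m (0 , 0) []
  long  : ∀ {a b π} → Shape m (a , b) π → Shape m (suc a , b) (m ∷ π)
  short : ∀ {a b π} → Shape m (a , b) π → Shape m (a , suc b) (suc m ∷ π)

length-Shape : ∀ {m c π} → Shape m c π → length π ≡ total c
length-Shape []                        = refl
length-Shape (long s)                  = cong suc (length-Shape s)
length-Shape {c = a , suc b} (short s) = trans (cong suc (length-Shape s)) (sym (+-suc a b))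

-- minExp (c ∷ x ∷ π) unfolds to minExp (c ⊓ x ∷ π), which drives the recursion.
minExp-∷-Shape : ∀ {m a b π} c → m ≤ c → Shape m (a , b) π → c ≡ m ⊎ 0 < a → minExp (c ∷ π) ≡ m
minExp-∷-Shape c m≤c [] (inj₁ c≡m) = c≡m
minExp-∷-Shape {m} c m≤c (long s) _
  rewrite m≥n⇒m⊓n≡n m≤c = minExp-∷-Shape m ≤-refl s (inj₁ refl)
minExp-∷-Shape {m} c m≤c (short s) (inj₁ refl)
  rewrite m≤n⇒m⊓n≡m (n≤1+n m) = minExp-∷-Shape m ≤-refl s (inj₁ refl)
minExp-∷-Shape {m} c m≤c (short s) (inj₂ 0<a) =
  minExp-∷-Shape (c ⊓ suc m) (⊓-glb m≤c (n≤1+n m)) s (inj₂ 0<a)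

minExp-Shape : ∀ {m a b π} → Shape m (a , b) π → 0 < a → minExp π ≡ m
minExp-Shape {m} (long s)  _   = minExp-∷-Shape m ≤-refl s (inj₁ refl)
minExp-Shape {m} (short s) 0<a = minExp-∷-Shape (suc m) (n≤1+n m) s (inj₂ 0<a)

≡ᵇ-refl : ∀ m → (m ≡ᵇ m) ≡ true
≡ᵇ-refl zero    = refl
≡ᵇ-refl (suc m) = ≡ᵇ-refl m

1+n≡ᵇn : ∀ n → (suc n ≡ᵇ n) ≡ false
1+n≡ᵇn zero    = refl
1+n≡ᵇn (suc n) = 1+n≡ᵇn n

-- refine L S π is definitionally concatMap (refineAt L S (minExp π)) π.
refineAt : ℕ → ℕ → ℕ → ℕ → List ℕ
refineAt L S m k = if k ≡ᵇ m then replicate L (suc k) ++ replicate S (suc (suc k)) else k ∷ []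

Shape-cast : ∀ {m c c′ π} → c ≡ c′ → Shape m c π → Shape m c′ π
Shape-cast {m} {π = π} = subst (λ c → Shape m c π)

replicate-long : ∀ {m a b π} L → Shape m (a , b) π → Shape m (L + a , b) (replicate L m ++ π)
replicate-long zero    s = s
replicate-long (suc L) s = long (replicate-long L s)

replicate-short : ∀ {m a b π} S → Shape m (a , b) π → Shape m (a , S + b) (replicate S (suc m) ++ π)
replicate-short zero    s = s
replicate-short (suc S) s = short (replicate-short S s)

replicate-Shape : ∀ {m a b π} L S → Shape m (a , b) π →
                  Shape m (L + a , S + b) ((replicate L m ++ replicate S (suc m)) ++ π)
replicate-Shape {m} {π = π} L S s rewrite ++-assoc (replicate L m) (replicate S (suc m)) π =
  replicate-long L (replicate-short S s)

refineAt-Shape : ∀ {m c π} L S → Shape m c π →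
                 Shape (suc m) (refineCounts L S c) (concatMap (refineAt L S m) π)
refineAt-Shape L S [] = Shape-cast (cong₂ _,_ (sym (*-zeroʳ L)) (sym (*-zeroʳ S))) []
refineAt-Shape {m} L S (long {a} {b} s) rewrite ≡ᵇ-refl m =
  Shape-cast (cong₂ _,_ (counts-long L a b) (sym (*-suc S a))) (replicate-Shape L S (refineAt-Shape L S s))
  where
  counts-long : ∀ L a b → L + (b + L * a) ≡ b + L * suc a
  counts-long = solve-∀
refineAt-Shape {m} L S (short s) rewrite 1+n≡ᵇn m = long (refineAt-Shape L S s)

refine-Shape : ∀ {m a b π} L S → Shape m (a , b) π → 0 < a →
               Shape (suc m) (refineCounts L S (a , b)) (refine L S π)
refine-Shape {m} {π = π} L S s 0<a =
  subst (λ m′ → Shape (suc m) _ (concatMap (refineAt L S m′) π)) (sym (minExp-Shape s 0<a))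
    (refineAt-Shape L S s)

counts-long-positive : ∀ l S n → 0 < proj₁ (counts (suc l) S n)
counts-long-positive l S zero    = s≤s z≤n
counts-long-positive l S (suc n) with counts (suc l) S n | counts-long-positive l S n
... | a , b | 0<a = <-≤-trans 0<a (≤-trans (m≤n*m a (suc l)) (m≤n+m (suc l * a) b))

ρ^-Shape : ∀ l S n → Shape n (counts (suc l) S n) (ρ^ (suc l) S n)
ρ^-Shape l S zero    = long []
ρ^-Shape l S (suc n) = refine-Shape (suc l) S (ρ^-Shape l S n) (counts-long-positive l S n)

length-ρ^ : ∀ l S n → length (ρ^ (suc l) S n) ≡ total (counts (suc l) S n)
length-ρ^ l S n = length-Shape (ρ^-Shape l S n)

CountsCorrespond : ℕ × ℕ → ℕ × ℕ → Set
CountsCorrespond (x , y) (a , b) = a + y ≡ x × b ≡ 2 * y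

CountsCorrespond-refine : ∀ {p q} → CountsCorrespond p q →
  CountsCorrespond (refineCounts 4 1 p) (refineCounts 1 1 (refineCounts 1 1 (refineCounts 1 1 q)))
CountsCorrespond-refine {.(a + y) , y} {a , .(2 * y)} (refl , refl) = long-eq a y , short-eq a y
  where
  long-eq : ∀ a y → 1 * (2 * y + 1 * a) + 1 * (1 * a + 1 * (2 * y + 1 * a)) + 1 * (a + y)
                    ≡ y + 4 * (a + y)
  long-eq = solve-∀
  short-eq : ∀ a y → 1 * (1 * a + 1 * (2 * y + 1 * a)) ≡ 2 * (1 * (a + y))
  short-eq = solve-∀

counts-correspond : ∀ n → CountsCorrespond (counts 4 1 n) (counts 1 1 (3 * n))
counts-correspond zero    = refl , refl
counts-correspond (suc n) =
  subst (λ k → CountsCorrespond (counts 4 1 (suc n)) (counts 1 1 k)) (sym (*-suc 3 n))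
    (CountsCorrespond-refine (counts-correspond n))

CountsCorrespond⇒total≡ : ∀ {p q} → CountsCorrespond p q → total p ≡ total q
CountsCorrespond⇒total≡ {.(a + y) , y} {a , .(2 * y)} (refl , refl) = total-eq a y
  where
  total-eq : ∀ a y → a + y + y ≡ a + 2 * y
  total-eq = solve-∀

proposition7 : ∀ (n : ℕ) → t′ n ≡ t (3 * n)
proposition7 n = begin
  t′ n                       ≡⟨ length-ρ^ 3 1 n ⟩
  total (counts 4 1 n)       ≡⟨ CountsCorrespond⇒total≡ (counts-correspond n) ⟩
  total (counts 1 1 (3 * n)) ≡⟨ length-ρ^ 0 1 (3 * n) ⟨
  t (3 * n)                  ∎
  where open ≡-Reasoning
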